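{- Let $K$ be a square-free graph. Then the map from $\pi_{/\sim}(K)$ to $\pi(K)$ sending $[W]$ to $\overline{W}$, for any walk $W$ in $K$, is well defined and is a groupoid isomorphism.
   Context: All graphs are finite, simple, loopless. An oriented edge $uv$ of $G$ is an ordered pair with $\{u,v\}\in E(G)$; $e^{ -1}=vu$. A walk is a finite sequence of oriented edges, each starting where the previous ends; $WW'$ denotes concatenation, $W^{ -1}$ the reversed walk, $\varepsilon$ the empty walk. A walk is reduced if it never contains consecutive edges $e,e^{ -1}$; $\overline{W}$ is the unique reduced walk obtained from $W$ by repeatedly deleting such pairs. The fundamental groupoid $\pi(G)$ is the set of reduced walks with inversion and the partial product $W\cdot W'=\overline{WW'}$ (defined when $W$ ends where $W'$ starts). A square is a quadruple $v_1,v_2,v_3,v_4$ with $v_1v_2,v_2v_3,v_3v_4,v_4v_1$ edges; non-trivial if $v_1\ne v_3$ and $v_2\ne v_4$; a graph is square-free if it has no non-trivial square. The relation $\sim$ on walks of $G$ is the smallest equivalence relation such that $W\sim\overline{W}$ and $W\,v_1v_2\,v_2v_3\,W'\sim W\,v_1v_4\,v_4v_3\,W'$ for all walks $W,W'$ and every square $v_1,v_2,v_3,v_4$ of $G$. $[W]$ is the class of $W$, and $\pi_{/\sim}(G)$ is the quotient groupoid of classes with $[W]\cdot[W']=[WW']$ and $[W]^{ -1}=[W^{ -1}]$. -}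

module Defs where

open import Data.Nat using (ℕ)
open import Data.Fin using (Fin; _≟_)
open import Data.Bool using (Bool; T)
open import Data.Unit using (⊤)
open import Data.Empty using (⊥)
open import Data.Product using (_×_)
open import Relation.Nullary using (¬_; yes; no)
open import Relation.Binary.PropositionalEquality using (_≡_; _≢_; refl)

record Graph : Set where
  field
    n     : ℕ
    adj   : Fin n → Fin n → Bool
    adj-sym    : ∀ u v → T (adj u v) → T (adj v u)
    adj-irrefl : ∀ v → ¬ T (adj v v)

open Graph public

module _ (K : Graph) where

  V : Set
  V = Fin (n K)

  -- An oriented edge uv (there is at most one, since T b is a proposition).
  Edge : V → V → Set
  Edge u v = T (adj K u v)

  data Walk : V → V → Set where
    []  : ∀ {v} → Walk v v
    _∷_ : ∀ {u v w} → Edge u v → Walk v w → Walk u w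

  infixr 5 _∷_ _++_

  _++_ : ∀ {u v w} → Walk u v → Walk v w → Walk u w
  [] ++ W' = W'
  (e ∷ W) ++ W' = e ∷ (W ++ W')

  inv : ∀ {u v} → Edge u v → Edge v u
  inv {u} {v} e = adj-sym K u v e

  rev : ∀ {u v} → Walk u v → Walk v u
  rev [] = []
  rev (e ∷ W) = rev W ++ (inv e ∷ [])

  -- Reduced: never two consecutive edges e, e⁻¹ (an edge v x following u v
  -- is u v's inverse exactly when x ≡ u).
  Reduced : ∀ {u w} → Walk u w → Set
  Reduced [] = ⊤
  Reduced (e ∷ []) = ⊤
  Reduced {u} (_∷_ e (_∷_ {v = x} e' W)) = (x ≢ u) × Reduced (e' ∷ W)

  cons : ∀ {u v w} → Edge u v → Walk v w → Walk u w
  cons e [] = e ∷ []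
  cons {u} e (_∷_ {v = x} e' W) with x ≟ u
  ... | yes refl = W
  ... | no _ = e ∷ e' ∷ W

  -- W̄ : the reduced walk obtained from W by repeatedly deleting pairs e e⁻¹
  reduce : ∀ {u w} → Walk u w → Walk u w
  reduce [] = []
  reduce (e ∷ W) = cons e (reduce W)

  -- product in the fundamental groupoid π(K) of reduced walks: W · W' = (WW')‾
  _·_ : ∀ {u v w} → Walk u v → Walk v w → Walk u w
  W · W' = reduce (W ++ W')

  Square : V → V → V → V → Set
  Square v₁ v₂ v₃ v₄ = Edge v₁ v₂ × Edge v₂ v₃ × Edge v₃ v₄ × Edge v₄ v₁

  NonTrivialSquare : V → V → V → V → Set
  NonTrivialSquare v₁ v₂ v₃ v₄ = Square v₁ v₂ v₃ v₄ × v₁ ≢ v₃ × v₂ ≢ v₄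

  SquareFree : Set
  SquareFree = ∀ v₁ v₂ v₃ v₄ → ¬ NonTrivialSquare v₁ v₂ v₃ v₄

  data _∼_ : ∀ {u w} → Walk u w → Walk u w → Set where
    ∼-red    : ∀ {u w} (W : Walk u w) → W ∼ reduce W
    ∼-square : ∀ {u w v₁ v₂ v₃ v₄} (W : Walk u v₁) (W' : Walk v₃ w)
               (e₁₂ : Edge v₁ v₂) (e₂₃ : Edge v₂ v₃) (e₃₄ : Edge v₃ v₄) (e₄₁ : Edge v₄ v₁) →
               (W ++ e₁₂ ∷ e₂₃ ∷ W') ∼ (W ++ inv e₄₁ ∷ inv e₃₄ ∷ W')
    ∼-refl   : ∀ {u w} {W : Walk u w} → W ∼ W
    ∼-sym    : ∀ {u w} {W W' : Walk u w} → W ∼ W' → W' ∼ W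
    ∼-trans  : ∀ {u w} {W W' W'' : Walk u w} → W ∼ W' → W' ∼ W'' → W ∼ W''

-- The reduced walk W̄ is a normal form for free reduction, and W ↦ W̄ is
-- compatible with concatenation and reversal because prepending an edge to a
-- reduced walk either extends it or cancels its first edge. Of the two
-- generators of ∼, W ∼ W̄ is preserved trivially; a square move changes
-- v₁v₂ v₂v₃ into v₁v₄ v₄v₃, and in a square-free graph every square is
-- degenerate: if v₂ = v₄ the two paths coincide, and if v₁ = v₃ both are
-- backtracks and vanish under reduction. Hence [W] ↦ W̄ is well defined,
-- and it is injective because W ∼ W̄ holds by definition of ∼.
module Submission where

open import Defs
open import Data.Bool.Properties using (T-irrelevant)
open import Data.Empty using (⊥-elim)
open import Data.Fin using (_≟_)
open import Data.Product using (_×_; Σ; _,_; proj₁; proj₂)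
open import Data.Unit using (tt)
open import Relation.Binary.PropositionalEquality
  using (_≡_; _≢_; refl; sym; trans; cong; cong₂; subst; module ≡-Reasoning)
open import Relation.Nullary using (yes; no)

module _ (K : Graph) where

  infixr 5 _⊕_
  _⊕_ : ∀ {u v w} → Walk K u v → Walk K v w → Walk K u w
  _⊕_ = _++_ K

  ++-identityʳ : ∀ {u w} (A : Walk K u w) → A ⊕ [] ≡ A
  ++-identityʳ []      = refl
  ++-identityʳ (e ∷ A) = cong (e ∷_) (++-identityʳ A)

  ++-assoc : ∀ {a b c d} (A : Walk K a b) (B : Walk K b c) (C : Walk K c d) →
             (A ⊕ B) ⊕ C ≡ A ⊕ (B ⊕ C)
  ++-assoc []      B C = refl
  ++-assoc (e ∷ A) B C = cong (e ∷_) (++-assoc A B C)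

  rev-++ : ∀ {a b c} (A : Walk K a b) (B : Walk K b c) → rev K (A ⊕ B) ≡ rev K B ⊕ rev K A
  rev-++ []      B = sym (++-identityʳ (rev K B))
  rev-++ (e ∷ A) B = trans (cong (_⊕ inv K e ∷ []) (rev-++ A B))
                           (++-assoc (rev K B) (rev K A) (inv K e ∷ []))

  rev-involutive : ∀ {a b} (A : Walk K a b) → rev K (rev K A) ≡ A
  rev-involutive []      = refl
  rev-involutive (e ∷ A) = trans (rev-++ (rev K A) (inv K e ∷ []))
                                 (cong₂ _∷_ (T-irrelevant _ _) (rev-involutive A))

  Reduced-tail : ∀ {u v w} (e : Edge K u v) (W : Walk K v w) → Reduced K (e ∷ W) → Reduced K W
  Reduced-tail e []             r = tt
  Reduced-tail e (e' ∷ [])      r = tt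
  Reduced-tail e (e' ∷ e'' ∷ W) r = proj₂ r

  cons-Reduced : ∀ {u v w} (e : Edge K u v) (W : Walk K v w) → Reduced K W → Reduced K (cons K e W)
  cons-Reduced e [] r = tt
  cons-Reduced {u} e (_∷_ {v = x} e' W) r with x ≟ u
  ... | yes refl = Reduced-tail e' W r
  ... | no x≢u   = x≢u , r

  reduce-Reduced : ∀ {u w} (W : Walk K u w) → Reduced K (reduce K W)
  reduce-Reduced []      = tt
  reduce-Reduced (e ∷ W) = cons-Reduced e (reduce K W) (reduce-Reduced W)

  reduce-fixes-Reduced : ∀ {u w} (R : Walk K u w) → Reduced K R → reduce K R ≡ R
  reduce-fixes-Reduced []       r = refl
  reduce-fixes-Reduced (e ∷ []) r = refl
  reduce-fixes-Reduced {u} (_∷_ e (_∷_ {v = x} e' R)) (x≢u , r)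
    rewrite reduce-fixes-Reduced (e' ∷ R) r with x ≟ u
  ... | yes x≡u = ⊥-elim (x≢u x≡u)
  ... | no _    = refl

  reduce-idempotent : ∀ {u w} (W : Walk K u w) → reduce K (reduce K W) ≡ reduce K W
  reduce-idempotent W = reduce-fixes-Reduced (reduce K W) (reduce-Reduced W)

  -- cons e either cancels the e' that cons e' prepended, or restores the first
  -- edge of Y that cons e' cancelled (edges are unique by T-irrelevant).
  cons-cancel : ∀ {u v w} (e : Edge K u v) (e' : Edge K v u) (Y : Walk K u w) → Reduced K Y →
                cons K e (cons K e' Y) ≡ Y
  cons-cancel {u} e e' [] r with u ≟ u
  ... | yes refl = refl
  ... | no u≢u   = ⊥-elim (u≢u refl)
  cons-cancel {u} {v} e e' (_∷_ {v = y} f Y) r with y ≟ v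
  cons-cancel e e' (f ∷ []) r | yes refl = cong (_∷ []) (T-irrelevant e f)
  cons-cancel {u} e e' (f ∷ _∷_ {v = z} g Y) (z≢v , _) | yes refl with z ≟ u
  ... | yes z≡u = ⊥-elim (z≢v z≡u)
  ... | no _    = cong (λ h → h ∷ g ∷ Y) (T-irrelevant e f)
  cons-cancel {u} e e' (f ∷ Y) r | no _ with u ≟ u
  ... | yes refl = refl
  ... | no u≢u   = ⊥-elim (u≢u refl)

  reduce-cons-++ : ∀ {u v m w} (e : Edge K u v) (X : Walk K v m) (Y : Walk K m w) →
                   reduce K (cons K e X ⊕ Y) ≡ cons K e (reduce K (X ⊕ Y))
  reduce-cons-++ e [] Y = refl
  reduce-cons-++ {u} e (_∷_ {v = x} e' X) Y with x ≟ u
  ... | yes refl = sym (cons-cancel e e' (reduce K (X ⊕ Y)) (reduce-Reduced (X ⊕ Y)))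
  ... | no _     = refl

  reduce-++-reduceˡ : ∀ {u m w} (A : Walk K u m) (B : Walk K m w) →
                      reduce K (A ⊕ B) ≡ reduce K (reduce K A ⊕ B)
  reduce-++-reduceˡ []      B = refl
  reduce-++-reduceˡ (e ∷ A) B = trans (cong (cons K e) (reduce-++-reduceˡ A B))
                                      (sym (reduce-cons-++ e (reduce K A) B))

  reduce-++-reduceʳ : ∀ {u m w} (A : Walk K u m) (B : Walk K m w) →
                      reduce K (A ⊕ B) ≡ reduce K (A ⊕ reduce K B)
  reduce-++-reduceʳ []      B = sym (reduce-idempotent B)
  reduce-++-reduceʳ (e ∷ A) B = cong (cons K e) (reduce-++-reduceʳ A B)

  reduce-++ : ∀ {u m w} (A : Walk K u m) (B : Walk K m w) →
              reduce K (A ⊕ B) ≡ _·_ K (reduce K A) (reduce K B)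
  reduce-++ A B = trans (reduce-++-reduceˡ A B) (reduce-++-reduceʳ (reduce K A) B)

  Reduced⇒no-backtrack : ∀ {u w a b c} (A : Walk K u a) (f : Edge K a b) (g : Edge K b c)
                         (B : Walk K c w) → Reduced K (A ⊕ f ∷ g ∷ B) → c ≢ a
  Reduced⇒no-backtrack []      f g B r = proj₁ r
  Reduced⇒no-backtrack (e ∷ A) f g B r =
    Reduced⇒no-backtrack A f g B (Reduced-tail e _ r)

  no-backtrack⇒Reduced : ∀ {u w} (Y : Walk K u w) →
    (∀ {a b c} (A : Walk K u a) (f : Edge K a b) (g : Edge K b c) (B : Walk K c w) →
       Y ≡ A ⊕ f ∷ g ∷ B → c ≢ a) →
    Reduced K Y
  no-backtrack⇒Reduced []           _  = tt
  no-backtrack⇒Reduced (e ∷ [])     _  = tt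
  no-backtrack⇒Reduced (e ∷ e' ∷ W) nb =
    nb [] e e' W refl ,
    no-backtrack⇒Reduced (e' ∷ W) (λ A f g B eq → nb (e ∷ A) f g B (cong (e ∷_) eq))

  -- A backtrack f g in rev Y is a backtrack g⁻¹ f⁻¹ in Y.
  rev-Reduced : ∀ {u w} (Y : Walk K u w) → Reduced K Y → Reduced K (rev K Y)
  rev-Reduced {u} {w} Y r = no-backtrack⇒Reduced (rev K Y) λ A f g B revY≡ c≡a →
    Reduced⇒no-backtrack (rev K B) (inv K g) (inv K f) (rev K A)
      (subst (Reduced K) (Y-split A f g B revY≡) r) (sym c≡a)
    where
    open ≡-Reasoning
    Y-split : ∀ {a b c} (A : Walk K w a) (f : Edge K a b) (g : Edge K b c) (B : Walk K c u) →
              rev K Y ≡ A ⊕ f ∷ g ∷ B → Y ≡ rev K B ⊕ inv K g ∷ inv K f ∷ rev K A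
    Y-split A f g B revY≡ = begin
      Y                                                      ≡⟨ sym (rev-involutive Y) ⟩
      rev K (rev K Y)                                        ≡⟨ cong (rev K) revY≡ ⟩
      rev K (A ⊕ f ∷ g ∷ B)                                  ≡⟨ rev-++ A (f ∷ g ∷ B) ⟩
      ((rev K B ⊕ inv K g ∷ []) ⊕ inv K f ∷ []) ⊕ rev K A    ≡⟨ ++-assoc (rev K B ⊕ inv K g ∷ []) _ _ ⟩
      (rev K B ⊕ inv K g ∷ []) ⊕ inv K f ∷ rev K A           ≡⟨ ++-assoc (rev K B) _ _ ⟩
      rev K B ⊕ inv K g ∷ inv K f ∷ rev K A                  ∎

  reduce-rev-Reduced : ∀ {u w} (R : Walk K u w) → Reduced K R → reduce K (rev K R) ≡ rev K R
  reduce-rev-Reduced R r = reduce-fixes-Reduced (rev K R) (rev-Reduced R r)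

  reduce-rev-snoc : ∀ {u v w} (e : Edge K u v) (Y : Walk K v w) → Reduced K Y →
                    reduce K (rev K Y ⊕ inv K e ∷ []) ≡ rev K (cons K e Y)
  reduce-rev-snoc e [] r = refl
  reduce-rev-snoc {u} e (_∷_ {v = x} e' Y) r with x ≟ u
  ... | yes refl = begin
    reduce K ((rev K Y ⊕ inv K e' ∷ []) ⊕ inv K e ∷ [])  ≡⟨ cong (reduce K) (++-assoc (rev K Y) _ _) ⟩
    reduce K (rev K Y ⊕ inv K e' ∷ inv K e ∷ [])         ≡⟨ reduce-++-reduceʳ (rev K Y) _ ⟩
    reduce K (rev K Y ⊕ reduce K (inv K e' ∷ inv K e ∷ []))
      ≡⟨ cong (λ Z → reduce K (rev K Y ⊕ Z)) (cons-cancel (inv K e') (inv K e) [] tt) ⟩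
    reduce K (rev K Y ⊕ [])                              ≡⟨ cong (reduce K) (++-identityʳ (rev K Y)) ⟩
    reduce K (rev K Y)                                   ≡⟨ reduce-rev-Reduced Y (Reduced-tail e' Y r) ⟩
    rev K Y                                              ∎
    where open ≡-Reasoning
  ... | no x≢u = reduce-rev-Reduced (e ∷ e' ∷ Y) (x≢u , r)

  reduce-rev : ∀ {u w} (W : Walk K u w) → reduce K (rev K W) ≡ rev K (reduce K W)
  reduce-rev []      = refl
  reduce-rev (e ∷ W) = begin
    reduce K (rev K W ⊕ inv K e ∷ [])             ≡⟨ reduce-++-reduceˡ (rev K W) _ ⟩
    reduce K (reduce K (rev K W) ⊕ inv K e ∷ [])  ≡⟨ cong (λ Z → reduce K (Z ⊕ inv K e ∷ [])) (reduce-rev W) ⟩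
    reduce K (rev K (reduce K W) ⊕ inv K e ∷ [])  ≡⟨ reduce-rev-snoc e (reduce K W) (reduce-Reduced W) ⟩
    rev K (cons K e (reduce K W))                 ∎
    where open ≡-Reasoning

  reduce-≡⇒∼ : ∀ {u w} (W W' : Walk K u w) → reduce K W ≡ reduce K W' → _∼_ K W W'
  reduce-≡⇒∼ W W' W̄≡W̄' =
    ∼-trans (∼-red W) (subst (λ X → _∼_ K X W') (sym W̄≡W̄') (∼-sym (∼-red W')))

  module _ (square-free : SquareFree K) where

    cons-square : ∀ {v₁ v₂ v₃ v₄ w} (e₁₂ : Edge K v₁ v₂) (e₂₃ : Edge K v₂ v₃)
                  (e₃₄ : Edge K v₃ v₄) (e₄₁ : Edge K v₄ v₁) (Y : Walk K v₃ w) → Reduced K Y →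
                  cons K e₁₂ (cons K e₂₃ Y) ≡ cons K (inv K e₄₁) (cons K (inv K e₃₄) Y)
    cons-square {v₁} {v₂} {v₃} {v₄} e₁₂ e₂₃ e₃₄ e₄₁ Y r with v₁ ≟ v₃ | v₂ ≟ v₄
    ... | _ | yes refl =
      cong₂ (λ a b → cons K a (cons K b Y)) (T-irrelevant _ _) (T-irrelevant _ _)
    ... | yes refl | no _ =
      trans (cons-cancel e₁₂ e₂₃ Y r) (sym (cons-cancel (inv K e₄₁) (inv K e₃₄) Y r))
    ... | no v₁≢v₃ | no v₂≢v₄ =
      ⊥-elim (square-free v₁ v₂ v₃ v₄ ((e₁₂ , e₂₃ , e₃₄ , e₄₁) , v₁≢v₃ , v₂≢v₄))

    reduce-square : ∀ {u w v₁ v₂ v₃ v₄} (W : Walk K u v₁) (W' : Walk K v₃ w)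
                    (e₁₂ : Edge K v₁ v₂) (e₂₃ : Edge K v₂ v₃) (e₃₄ : Edge K v₃ v₄) (e₄₁ : Edge K v₄ v₁) →
                    reduce K (W ⊕ e₁₂ ∷ e₂₃ ∷ W') ≡ reduce K (W ⊕ inv K e₄₁ ∷ inv K e₃₄ ∷ W')
    reduce-square W W' e₁₂ e₂₃ e₃₄ e₄₁ = begin
      reduce K (W ⊕ e₁₂ ∷ e₂₃ ∷ W')                                   ≡⟨ reduce-++-reduceʳ W _ ⟩
      reduce K (W ⊕ cons K e₁₂ (cons K e₂₃ (reduce K W')))
        ≡⟨ cong (λ Z → reduce K (W ⊕ Z)) (cons-square e₁₂ e₂₃ e₃₄ e₄₁ _ (reduce-Reduced W')) ⟩
      reduce K (W ⊕ cons K (inv K e₄₁) (cons K (inv K e₃₄) (reduce K W')))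
        ≡⟨ sym (reduce-++-reduceʳ W _) ⟩
      reduce K (W ⊕ inv K e₄₁ ∷ inv K e₃₄ ∷ W')                       ∎
      where open ≡-Reasoning

    reduce-respects-∼ : ∀ {u w} (W W' : Walk K u w) → _∼_ K W W' → reduce K W ≡ reduce K W'
    reduce-respects-∼ W _  (∼-red .W)  = sym (reduce-idempotent W)
    reduce-respects-∼ _ _  (∼-square W W' e₁₂ e₂₃ e₃₄ e₄₁) = reduce-square W W' e₁₂ e₂₃ e₃₄ e₄₁
    reduce-respects-∼ W _  ∼-refl      = refl
    reduce-respects-∼ W W' (∼-sym p)   = sym (reduce-respects-∼ W' W p)
    reduce-respects-∼ W W' (∼-trans {W' = X} p q) =
      trans (reduce-respects-∼ W X p) (reduce-respects-∼ X W' q)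

lemma1 : (K : Graph) → SquareFree K →
    (∀ {u w} (W : Walk K u w) → Reduced K (reduce K W))
    × (∀ {u w} (W W' : Walk K u w) → _∼_ K W W' → reduce K W ≡ reduce K W')
    × (∀ {v} → reduce K ([] {K} {v}) ≡ [])
    × (∀ {u v w} (W : Walk K u v) (W' : Walk K v w) →
         reduce K (_++_ K W W') ≡ _·_ K (reduce K W) (reduce K W'))
    × (∀ {u w} (W : Walk K u w) → reduce K (rev K W) ≡ rev K (reduce K W))
    × (∀ {u w} (W W' : Walk K u w) → reduce K W ≡ reduce K W' → _∼_ K W W')
    × (∀ {u w} (R : Walk K u w) → Reduced K R → Σ (Walk K u w) (λ W → reduce K W ≡ R))
lemma1 K square-free =
  reduce-Reduced K ,
  reduce-respects-∼ K square-free ,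
  refl ,
  reduce-++ K ,
  reduce-rev K ,
  reduce-≡⇒∼ K ,
  λ R r → R , reduce-fixes-Reduced K R r
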